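{- For $n\geq 1$, the map $\phi$ is a bijection from $\mathcal{X}_n=\mathcal{T}_n\times\mathcal{T}_n$ onto the set $\mathcal{MD}_n$ of meandering diagrams of size $n$, and it restricts to a bijection from the set $\mathcal{I}_n$ of Tamari intervals of size $n$ onto the set $\mathcal{MT}_n$ of meandering trees of size $n$.
   Context: A binary tree is either a single leaf or a node with an ordered pair (left, right) of binary subtrees; its size is its number of nodes and $\mathcal{T}_n$ is the set of binary trees of size $n$. A right rotation replaces a subtree of the form $((A,B),C)$ by $(A,(B,C))$; the Tamari order $\le$ on $\mathcal{T}_n$ is the reflexive-transitive closure of single right rotations, and $\mathcal{I}_n=\{(T,T'): T\le T'\}$. For $T\in\mathcal{T}_n$ label its nodes $v_1,\dots,v_n$ in infix order and let $a_t(T)$ (resp. $b_t(T)$) be the number of nodes in the right (resp. left) subtree of $v_t$. $\phi(T,T')$ is the arc-diagram on the points $0,\tfrac12,\dots,n$ (integer points black, half-integer white) with, for each $t\in[n]$, an upper arc (semicircle in the upper half-plane) joining $t-\tfrac12$ to $t-1-b_t(T')$ and a lower arc (semicircle in the lower half-plane) joining $t-\tfrac12$ to $t+a_t(T)$. A meandering diagram of size $n$ is a non-crossing arc-diagram on these $2n+1$ points with arcs in the upper or lower half-plane, every upper arc having black left end and white right end, every lower arc having white left end and black right end, and each white point incident to exactly one upper and one lower arc. Its underlying graph has the black points as vertices and, for each white point, an edge joining the black ends of its two arcs; a meandering tree is a meandering diagram whose underlying graph is a tree. -}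

module Defs where

open import Data.Nat using (ℕ; zero; suc; _+_; _*_; _∸_; _≤_; _<_)
open import Data.Product using (Σ; _×_; _,_; ∃; proj₁; proj₂)
open import Data.Sum using (_⊎_)
open import Data.List using (List; []; _∷_; _++_; [_]; map)
open import Data.Maybe using (Maybe; just; nothing; maybe)
open import Data.List.Relation.Unary.Unique.Propositional using (Unique)
open import Relation.Binary.PropositionalEquality using (_≡_)
open import Relation.Binary.Construct.Closure.ReflexiveTransitive using (Star)
open import Relation.Nullary using (¬_)
open import Function.Bundles using (_⇔_)

data Tree : Set where
  leaf : Tree
  node : Tree → Tree → Tree

size : Tree → ℕ
size leaf       = 0
size (node l r) = suc (size l + size r)

data _⟶_ : Tree → Tree → Set where
  rot   : ∀ {A B C} → node (node A B) C ⟶ node A (node B C)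
  left  : ∀ {A A' B} → A ⟶ A' → node A B ⟶ node A' B
  right : ∀ {A B B'} → B ⟶ B' → node A B ⟶ node A B'

_≤T_ : Tree → Tree → Set
_≤T_ = Star _⟶_

-- Infix labelling: the t-th entry (0-based list position t-1) of
-- infixSizes T is (b_t(T), a_t(T)) = (#left subtree, #right subtree) of v_t.

infixSizes : Tree → List (ℕ × ℕ)
infixSizes leaf       = []
infixSizes (node l r) = infixSizes l ++ [ (size l , size r) ] ++ infixSizes r

nth : {A : Set} → List A → ℕ → Maybe A
nth []       _       = nothing
nth (x ∷ xs) zero    = just x
nth (x ∷ xs) (suc k) = nth xs k

-- a_t(T), b_t(T) for 1-based t (only used for 1 ≤ t ≤ size T)
aₜ : ℕ → Tree → ℕ
aₜ t T = maybe proj₂ 0 (nth (infixSizes T) (t ∸ 1))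

bₜ : ℕ → Tree → ℕ
bₜ t T = maybe proj₁ 0 (nth (infixSizes T) (t ∸ 1))

-- Points 0, 1/2, …, n are encoded by doubled coordinates
-- p ∈ {0,…,2n}, p representing p/2; black = even p, white = odd p.
-- A diagram is a set of arcs: D s i j means there is an arc in half-plane s
-- with left end i and right end j.

data Side : Set where
  upper lower : Side

ArcDiagram : Set₁
ArcDiagram = Side → ℕ → ℕ → Set

Black : ℕ → Set
Black p = ∃ λ k → p ≡ 2 * k

White : ℕ → Set
White p = ∃ λ k → p ≡ suc (2 * k)

_≈D_ : ArcDiagram → ArcDiagram → Set
D ≈D E = ∀ s i j → D s i j ⇔ E s i j

φ : ℕ → Tree → Tree → ArcDiagram
-- upper arc joining t - 1/2 to t - 1 - b_t(T')
φ n T T' upper i j = Σ ℕ λ t → 1 ≤ t × t ≤ n × i ≡ 2 * (t ∸ 1 ∸ bₜ t T') × j ≡ 2 * t ∸ 1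
-- lower arc joining t - 1/2 to t + a_t(T)
φ n T T' lower i j = Σ ℕ λ t → 1 ≤ t × t ≤ n × i ≡ 2 * t ∸ 1 × j ≡ 2 * (t + aₜ t T)

IsArcDiagram : ℕ → ArcDiagram → Set
IsArcDiagram n D = ∀ s i j → D s i j → i < j × j ≤ 2 * n

-- two semicircles on the same side cross iff their ends interleave strictly
NonCrossing : ArcDiagram → Set
NonCrossing D = ∀ s i j k l → D s i j → D s k l → ¬ (i < k × k < j × j < l)

Incident : ℕ → ℕ × ℕ → Set
Incident w (i , j) = i ≡ w ⊎ j ≡ w

ExactlyOneArc : ArcDiagram → Side → ℕ → Set
ExactlyOneArc D s w =
  Σ (ℕ × ℕ) λ a → D s (proj₁ a) (proj₂ a) × Incident w a ×
    (∀ b → D s (proj₁ b) (proj₂ b) → Incident w b → b ≡ a)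

record Meandering (n : ℕ) (D : ArcDiagram) : Set where
  field
    arcDiagram  : IsArcDiagram n D
    nonCrossing : NonCrossing D
    upperEnds   : ∀ i j → D upper i j → Black i × White j
    lowerEnds   : ∀ i j → D lower i j → White i × Black j
    whiteUpper  : ∀ w → White w → w ≤ 2 * n → ExactlyOneArc D upper w
    whiteLower  : ∀ w → White w → w ≤ 2 * n → ExactlyOneArc D lower w

-- Underlying graph: vertices are the black points; the white point w gives
-- an edge between the black ends of its upper arc and of its lower arc.

OtherEnd : ArcDiagram → Side → ℕ → ℕ → Set
OtherEnd D s w x = D s x w ⊎ D s w x

EdgeEnds : ℕ → ArcDiagram → ℕ → ℕ → ℕ → Set
EdgeEnds n D w x y = White w × w ≤ 2 * n × OtherEnd D upper w x × OtherEnd D lower w y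

Joins : ℕ → ArcDiagram → ℕ → ℕ → ℕ → Set
Joins n D w x y = EdgeEnds n D w x y ⊎ EdgeEnds n D w y x

-- walks from x to z; each step records (edge used, vertex it starts from)
data Walk (n : ℕ) (D : ArcDiagram) : ℕ → ℕ → List (ℕ × ℕ) → Set where
  nil  : ∀ {x} → Walk n D x x []
  step : ∀ {w x y z ps} → Joins n D w x y → Walk n D y z ps → Walk n D x z ((w , x) ∷ ps)

Vertex : ℕ → ℕ → Set
Vertex n x = Black x × x ≤ 2 * n

Connected : ℕ → ArcDiagram → Set
Connected n D = ∀ x y → Vertex n x → Vertex n y → ∃ λ ps → Walk n D x y ps

-- a cycle: closed walk of positive length, with pairwise distinct edges and
-- pairwise distinct vertices v₀,…,v_{k-1} (v_k = v₀)
Cycle : ℕ → ArcDiagram → Set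
Cycle n D = Σ ℕ λ x → Σ (ℕ × ℕ) λ p → Σ (List (ℕ × ℕ)) λ ps →
  Walk n D x x (p ∷ ps) × Unique (map proj₁ (p ∷ ps)) × Unique (map proj₂ (p ∷ ps))

IsTree : ℕ → ArcDiagram → Set
IsTree n D = Connected n D × ¬ Cycle n D

MeanderingTree : ℕ → ArcDiagram → Set
MeanderingTree n D = Meandering n D × IsTree n D

-- Index the nodes of a tree by their infix positions k = 0, …, n - 1. The subtree of node k then occupies
-- an interval of positions, from subtreeStart to subtreeEnd, and φ n T T' is read off these intervals: the
-- upper arc at k + 1/2 goes back to subtreeStart T' k, the lower arc forward to subtreeEnd T k + 1.
-- Non-crossing of the arcs on one side is exactly the nesting of such intervals, and a tree is determined
-- by (and can be rebuilt from) either family of endpoints; so φ is a bijection onto meandering diagrams.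
-- The Tamari order T ≤ T' amounts to a_t(T) ≤ a_t(T') for all t, since a rotation only enlarges one right
-- subtree and, conversely, rotations can bring T into the shape of the root split of T'. Under this
-- inequality the interval of black points spanned by a subtree of T' is joined to its left end and
-- crossed over its root only by the edge of the root; so the graph is connected and every cycle would
-- have to cross that edge an even number of times, i.e. it is a tree. Conversely, at the last t with
-- a_t(T) > a_t(T') the black points from t + 1 to the end of the subtree of node t in T' are closed
-- under edges yet miss the black point n, so the graph is disconnected.

module Submission where

open import Defs
open import Data.Nat using (ℕ; zero; suc; _+_; _*_; _∸_; _≤_; _<_; z≤n; s≤s; _≤?_; _<?_; _≟_)
open import Data.Nat.Properties
open import Data.Product using (Σ; _×_; _,_; ∃; proj₁; proj₂)
open import Data.Sum using (_⊎_; inj₁; inj₂)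
open import Data.List using (List; []; _∷_; _++_; map; length)
open import Data.List.Properties using (length-++; ++-assoc)
open import Data.Maybe using (Maybe; just; maybe)
open import Data.Empty using (⊥; ⊥-elim)
open import Relation.Nullary using (¬_; yes; no; Dec)
open import Relation.Binary.Definitions using (tri<; tri≈; tri>)
open import Function.Bundles using (_⇔_; mk⇔; Equivalence)
open import Induction.WellFounded using (Acc; acc)
open import Data.List.Relation.Binary.Pointwise as Pointwise using (Pointwise; []; _∷_; ++⁺; Pointwise-length)
open import Data.List.Relation.Unary.All as All using (All; []; _∷_)
open import Data.List.Relation.Unary.All.Properties using (All¬⇒¬Any)
open import Data.List.Relation.Unary.Any using (here; there; any?)
open import Data.List.Relation.Unary.AllPairs using (_∷_)
open import Data.List.Relation.Unary.Unique.Propositional using (Unique)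
open import Data.List.Membership.Propositional using (_∈_; _∉_)
open import Function.Properties.Equivalence using (⇔-isEquivalence)
open import Relation.Binary.Structures using (IsEquivalence)
open import Level using (0ℓ)
open import Relation.Binary.Construct.Closure.ReflexiveTransitive using (ε; _◅_; _◅◅_; gmap)
open import Data.Nat.Induction using (<-wellFounded)
open import Relation.Binary.PropositionalEquality
  using (_≡_; refl; sym; trans; cong; cong₂; subst; subst₂; _≢_; module ≡-Reasoning)

suc-+-cancelˡ-< : ∀ m {x y} → suc (m + x) < suc (m + y) → x < y
suc-+-cancelˡ-< m (s≤s p) = +-cancelˡ-< m _ _ p

suc-+-cancelˡ-≤ : ∀ m {x y} → suc (m + x) ≤ suc (m + y) → x ≤ y
suc-+-cancelˡ-≤ m (s≤s p) = +-cancelˡ-≤ m _ _ p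

suc-+-monoʳ-≤ : ∀ m {x y} → x ≤ y → suc (m + x) ≤ suc (m + y)
suc-+-monoʳ-≤ m p = s≤s (+-monoʳ-≤ m p)

suc-+-monoʳ-< : ∀ m {x y} → x < y → suc (m + x) < suc (m + y)
suc-+-monoʳ-< m p = s≤s (+-monoʳ-< m p)

m<suc[m+n] : ∀ m n → m < suc (m + n)
m<suc[m+n] m n = s≤s (m≤m+n m n)

suc[m+n]+o≡m+suc[n+o] : ∀ m n o → suc (m + n) + o ≡ m + suc (n + o)
suc[m+n]+o≡m+suc[n+o] m n o = trans (cong suc (+-assoc m n o)) (sym (+-suc m (n + o)))

split≤ : ∀ {p L} → p ≤ L → Σ ℕ λ q → L ≡ p + q
split≤ {p} {L} le = L ∸ p , sym (m+[n∸m]≡n le)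

double-mono-≤ : ∀ {x y} → x ≤ y → 2 * x ≤ 2 * y
double-mono-≤ = *-monoʳ-≤ 2

double-cancel-≤ : ∀ {x y} → 2 * x ≤ 2 * y → x ≤ y
double-cancel-≤ = *-cancelˡ-≤ 2

double-cancel-< : ∀ {x y} → 2 * x < 2 * y → x < y
double-cancel-< {x} {y} = *-cancelˡ-< 2 x y

double-injective : ∀ {x y} → 2 * x ≡ 2 * y → x ≡ y
double-injective {x} {y} = *-cancelˡ-≡ x y 2

odd-injective : ∀ {x y} → suc (2 * x) ≡ suc (2 * y) → x ≡ y
odd-injective e = double-injective (suc-injective e)

even<odd⇒≤ : ∀ {x y} → 2 * x < suc (2 * y) → x ≤ y
even<odd⇒≤ p = double-cancel-≤ (≤-pred p)

odd<odd⇒< : ∀ {x y} → suc (2 * x) < suc (2 * y) → x < y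
odd<odd⇒< p = double-cancel-< (≤-pred p)

odd≤even⇒< : ∀ {x y} → suc (2 * x) ≤ 2 * y → x < y
odd≤even⇒< = double-cancel-<

<⇒odd≤even : ∀ {x y} → x < y → suc (2 * x) ≤ 2 * y
<⇒odd≤even {x} {y} p = ≤-trans (n≤1+n _) (subst (_≤ 2 * y) (*-suc 2 x) (double-mono-≤ p))

2*suc∸1 : ∀ k → 2 * suc k ∸ 1 ≡ suc (2 * k)
2*suc∸1 k = +-suc k (k + 0)

<-suc-elim : {Q : ℕ → Set} {m k : ℕ} → Q m → (k < m → Q k) → k < suc m → Q k
<-suc-elim Qm Qk k<1+m with m≤n⇒m<n∨m≡n (≤-pred k<1+m)
... | inj₁ k<m = Qk k<m
... | inj₂ refl = Qm

greatestWitness : {P : ℕ → Set} → (∀ q → Dec (P q)) → P 0 → ∀ L →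
                  Σ ℕ λ p → p ≤ L × P p × (∀ q → p < q → q ≤ L → ¬ P q)
greatestWitness {P} P? P0 zero = 0 , z≤n , P0 , λ q p<q q≤0 _ → <⇒≱ p<q q≤0
greatestWitness {P} P? P0 (suc L) with P? (suc L) | greatestWitness P? P0 L
... | yes PL | _ = suc L , ≤-refl , PL , λ q p<q q≤L _ → <⇒≱ p<q q≤L
... | no ¬PL | p , p≤L , Pp , greatest =
  p , m≤n⇒m≤1+n p≤L , Pp ,
  λ q p<q q≤ → <-suc-elim {λ q → ¬ P q} ¬PL (λ q<1+L → greatest q p<q (≤-pred q<1+L)) (s≤s q≤)

leastWitness : {P : ℕ → Set} → (∀ q → Dec (P q)) → ∀ L → P L →
               Σ ℕ λ p → p ≤ L × P p × (∀ q → q < p → ¬ P q)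
leastWitness {P} P? zero PL = 0 , z≤n , PL , λ _ ()
leastWitness {P} P? (suc L) PL with P? 0
... | yes P0 = 0 , z≤n , P0 , λ _ ()
... | no ¬P0 with leastWitness (λ q → P? (suc q)) L PL
...   | p , p≤L , Pp , least = suc p , s≤s p≤L , Pp , least'
  where
  least' : ∀ q → q < suc p → ¬ P q
  least' zero _ = ¬P0
  least' (suc q) (s≤s q<p) = least q q<p

lastCounterexample : {P : ℕ → Set} → (∀ k → Dec (P k)) → ∀ m →
                     (∀ k → k < m → P k) ⊎ Σ ℕ λ j → j < m × ¬ P j × (∀ k → j < k → k < m → P k)
lastCounterexample P? zero = inj₁ λ _ ()
lastCounterexample P? (suc m) with P? m | lastCounterexample P? m
... | no ¬Pm | _ = inj₂ (m , ≤-refl , ¬Pm , λ k m<k k<1+m → ⊥-elim (<⇒≱ m<k (≤-pred k<1+m)))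
... | yes Pm | inj₁ below = inj₁ (λ k → <-suc-elim Pm (below k))
... | yes Pm | inj₂ (j , j<m , ¬Pj , above) =
  inj₂ (j , m≤n⇒m≤1+n j<m , ¬Pj , λ k j<k → <-suc-elim Pm (above k j<k))

boundedChoice : ∀ {n} {P : ℕ → ℕ → Set} → (∀ {k} → k < n → Σ ℕ (P k)) → ℕ → ℕ
boundedChoice {n} choose k with k <? n
... | yes k<n = proj₁ (choose k<n)
... | no _ = 0

boundedChoice-spec : ∀ {n} {P : ℕ → ℕ → Set} (choose : ∀ {k} → k < n → Σ ℕ (P k)) →
                     ∀ {k} → k < n → P k (boundedChoice choose k)
boundedChoice-spec {n} choose {k} k<n with k <? n
... | yes k<n′ = proj₂ (choose k<n′)
... | no k≮n = ⊥-elim (k≮n k<n)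

nth-++ˡ : ∀ {X : Set} (xs ys : List X) {k} → k < length xs → nth (xs ++ ys) k ≡ nth xs k
nth-++ˡ (x ∷ xs) ys {zero} _ = refl
nth-++ˡ (x ∷ xs) ys {suc k} (s≤s p) = nth-++ˡ xs ys p

nth-++ʳ : ∀ {X : Set} (xs ys : List X) k → nth (xs ++ ys) (length xs + k) ≡ nth ys k
nth-++ʳ [] ys k = refl
nth-++ʳ (x ∷ xs) ys k = nth-++ʳ xs ys k

_≤₂_ : ℕ × ℕ → ℕ × ℕ → Set
x ≤₂ y = proj₂ x ≤ proj₂ y

_≤₂*_ : List (ℕ × ℕ) → List (ℕ × ℕ) → Set
_≤₂*_ = Pointwise _≤₂_

≤₂*-refl : ∀ {xs} → xs ≤₂* xs
≤₂*-refl = Pointwise.refl ≤-refl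

≤₂*-trans : ∀ {xs ys zs} → xs ≤₂* ys → ys ≤₂* zs → xs ≤₂* zs
≤₂*-trans = Pointwise.transitive ≤-trans

≤₂*-++⁻ : ∀ {xs xs' ys ys'} → length xs ≡ length xs' →
          (xs ++ ys) ≤₂* (xs' ++ ys') → xs ≤₂* xs' × ys ≤₂* ys'
≤₂*-++⁻ {[]} {[]} _ le = [] , le
≤₂*-++⁻ {x ∷ xs} {x' ∷ xs'} e (p ∷ le) with ≤₂*-++⁻ {xs} {xs'} (suc-injective e) le
... | front , back = p ∷ front , back

≤₂*⇒nth≤ : ∀ {xs ys} → xs ≤₂* ys → ∀ k → maybe proj₂ 0 (nth xs k) ≤ maybe proj₂ 0 (nth ys k)
≤₂*⇒nth≤ [] k = z≤n
≤₂*⇒nth≤ (p ∷ le) zero = p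
≤₂*⇒nth≤ (p ∷ le) (suc k) = ≤₂*⇒nth≤ le k

nth≤⇒≤₂* : ∀ {xs ys} → length xs ≡ length ys →
           (∀ k → k < length xs → maybe proj₂ 0 (nth xs k) ≤ maybe proj₂ 0 (nth ys k)) → xs ≤₂* ys
nth≤⇒≤₂* {[]} {[]} _ _ = []
nth≤⇒≤₂* {x ∷ xs} {y ∷ ys} e le =
  le 0 (s≤s z≤n) ∷ nth≤⇒≤₂* (suc-injective e) (λ k p → le (suc k) (s≤s p))

-- With 0-based positions k = t - 1: leftSize T k = b_t(T), rightSize T k = a_t(T), and the
-- subtree rooted at v_t occupies the infix positions subtreeStart T k, …, subtreeEnd T k.

infixAt : Tree → ℕ → Maybe (ℕ × ℕ)
infixAt T = nth (infixSizes T)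

leftSize rightSize subtreeStart subtreeEnd : Tree → ℕ → ℕ
leftSize T k = maybe proj₁ 0 (infixAt T k)
rightSize T k = maybe proj₂ 0 (infixAt T k)
subtreeStart T k = k ∸ leftSize T k
subtreeEnd T k = k + rightSize T k

length-infixSizes : ∀ T → length (infixSizes T) ≡ size T
length-infixSizes leaf = refl
length-infixSizes (node l r) = begin
  length (infixSizes l ++ (size l , size r) ∷ infixSizes r)
    ≡⟨ length-++ (infixSizes l) ⟩
  length (infixSizes l) + suc (length (infixSizes r))
    ≡⟨ cong₂ (λ a b → a + suc b) (length-infixSizes l) (length-infixSizes r) ⟩
  size l + suc (size r)
    ≡⟨ +-suc (size l) (size r) ⟩
  suc (size l + size r)
    ∎
  where open ≡-Reasoning

data NodePosition (m : ℕ) : ℕ → Set where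
  inLeft  : ∀ {k} → k < m → NodePosition m k
  atRoot  : NodePosition m m
  inRight : ∀ k → NodePosition m (suc (m + k))

nodePosition : ∀ m k → NodePosition m k
nodePosition zero zero = atRoot
nodePosition zero (suc k) = inRight k
nodePosition (suc m) zero = inLeft (s≤s z≤n)
nodePosition (suc m) (suc k) with nodePosition m k
... | inLeft p  = inLeft (s≤s p)
... | atRoot    = atRoot
... | inRight k = inRight k

module _ (l r : Tree) where
  private
    T = node l r
    offset : ∀ k → length (infixSizes l) + k ≡ size l + k
    offset k = cong (_+ k) (length-infixSizes l)

  infixAt-left : ∀ {k} → k < size l → infixAt T k ≡ infixAt l k
  infixAt-left p = nth-++ˡ (infixSizes l) _ (subst (_ <_) (sym (length-infixSizes l)) p)

  infixAt-root : infixAt T (size l) ≡ just (size l , size r)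
  infixAt-root = trans (cong (nth (infixSizes T)) (trans (sym (+-identityʳ _)) (sym (offset 0))))
                       (nth-++ʳ (infixSizes l) _ 0)

  infixAt-right : ∀ k → infixAt T (suc (size l + k)) ≡ infixAt r k
  infixAt-right k = trans (cong (nth (infixSizes T)) (trans (sym (+-suc (size l) k)) (sym (offset (suc k)))))
                          (nth-++ʳ (infixSizes l) _ (suc k))

  leftSize-left : ∀ {k} → k < size l → leftSize T k ≡ leftSize l k
  leftSize-left p = cong (maybe proj₁ 0) (infixAt-left p)

  rightSize-left : ∀ {k} → k < size l → rightSize T k ≡ rightSize l k
  rightSize-left p = cong (maybe proj₂ 0) (infixAt-left p)

  subtreeStart-left : ∀ {k} → k < size l → subtreeStart T k ≡ subtreeStart l k
  subtreeStart-left {k} p = cong (k ∸_) (leftSize-left p)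

  subtreeEnd-left : ∀ {k} → k < size l → subtreeEnd T k ≡ subtreeEnd l k
  subtreeEnd-left {k} p = cong (k +_) (rightSize-left p)

  leftSize-root : leftSize T (size l) ≡ size l
  leftSize-root = cong (maybe proj₁ 0) infixAt-root

  rightSize-root : rightSize T (size l) ≡ size r
  rightSize-root = cong (maybe proj₂ 0) infixAt-root

  subtreeStart-root : subtreeStart T (size l) ≡ 0
  subtreeStart-root = trans (cong (size l ∸_) leftSize-root) (n∸n≡0 (size l))

  subtreeEnd-root : subtreeEnd T (size l) ≡ size l + size r
  subtreeEnd-root = cong (size l +_) rightSize-root

  leftSize-right : ∀ k → leftSize T (suc (size l + k)) ≡ leftSize r k
  leftSize-right k = cong (maybe proj₁ 0) (infixAt-right k)

  rightSize-right : ∀ k → rightSize T (suc (size l + k)) ≡ rightSize r k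
  rightSize-right k = cong (maybe proj₂ 0) (infixAt-right k)

  subtreeEnd-right : ∀ k → subtreeEnd T (suc (size l + k)) ≡ suc (size l + subtreeEnd r k)
  subtreeEnd-right k = begin
    suc (size l + k) + rightSize T (suc (size l + k)) ≡⟨ cong (suc (size l + k) +_) (rightSize-right k) ⟩
    suc (size l + k) + rightSize r k                  ≡⟨ cong suc (+-assoc (size l) k _) ⟩
    suc (size l + subtreeEnd r k)                     ∎
    where open ≡-Reasoning

subtreeStart≤ : ∀ T k → subtreeStart T k ≤ k
subtreeStart≤ T k = m∸n≤m k (leftSize T k)

≤subtreeEnd : ∀ T k → k ≤ subtreeEnd T k
≤subtreeEnd T k = m≤m+n k (rightSize T k)

leftSize≤ : ∀ T k → k < size T → leftSize T k ≤ k
leftSize≤ (node l r) k p with nodePosition (size l) k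
... | inLeft q   rewrite leftSize-left l r q = leftSize≤ l k q
... | atRoot     rewrite leftSize-root l r = ≤-refl
... | inRight k' rewrite leftSize-right l r k' =
  m≤n⇒m≤1+n (≤-trans (leftSize≤ r k' (suc-+-cancelˡ-< (size l) p)) (m≤n+m k' (size l)))

subtreeStart-right : ∀ l r {k} → k < size r →
                     subtreeStart (node l r) (suc (size l + k)) ≡ suc (size l + subtreeStart r k)
subtreeStart-right l r {k} p = begin
  suc (size l + k) ∸ leftSize (node l r) (suc (size l + k)) ≡⟨ cong (suc (size l + k) ∸_) (leftSize-right l r k) ⟩
  suc (size l + k) ∸ leftSize r k                           ≡⟨ +-∸-assoc (suc (size l)) (leftSize≤ r k p) ⟩
  suc (size l + subtreeStart r k)                           ∎
  where open ≡-Reasoning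

subtreeEnd<size : ∀ T k → k < size T → subtreeEnd T k < size T
subtreeEnd<size (node l r) k p with nodePosition (size l) k
... | inLeft q   rewrite subtreeEnd-left l r q =
  ≤-trans (subtreeEnd<size l k q) (m≤n⇒m≤1+n (m≤m+n (size l) (size r)))
... | atRoot     rewrite subtreeEnd-root l r = ≤-refl
... | inRight k' rewrite subtreeEnd-right l r k' =
  suc-+-monoʳ-< (size l) (subtreeEnd<size r k' (suc-+-cancelˡ-< (size l) p))

private
  right-of-root : ∀ m k' {j} → j ≤ m → ¬ suc (m + k') ≤ j
  right-of-root m k' j≤m p = <⇒≱ (≤-<-trans (m≤m+n m k') p) j≤m

  left-of-right : ∀ m k' {j} → j ≤ m → ¬ suc (m + k') < j
  left-of-right m k' j≤m p = right-of-root m k' j≤m (<⇒≤ p)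

-- The subtrees of a tree are nested: these are the laminarity properties behind non-crossing.

subtreeStart-nested : ∀ T {j k} → j < k → k < size T →
                      subtreeStart T k ≤ j → subtreeStart T k ≤ subtreeStart T j
subtreeStart-nested (node l r) {j} {k} j<k k<n h with nodePosition (size l) k
... | inLeft q rewrite subtreeStart-left l r q | subtreeStart-left l r (<-trans j<k q) =
  subtreeStart-nested l j<k q h
... | atRoot rewrite subtreeStart-root l r = z≤n
... | inRight k' rewrite subtreeStart-right l r (suc-+-cancelˡ-< (size l) k<n) with nodePosition (size l) j
...   | inLeft q   = ⊥-elim (right-of-root (size l) _ (<⇒≤ q) h)
...   | atRoot     = ⊥-elim (right-of-root (size l) _ ≤-refl h)
...   | inRight j' rewrite subtreeStart-right l r (suc-+-cancelˡ-< (size l) (<-trans j<k k<n)) =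
  suc-+-monoʳ-≤ (size l) (subtreeStart-nested r (suc-+-cancelˡ-< (size l) j<k) (suc-+-cancelˡ-< (size l) k<n)
                                                (suc-+-cancelˡ-≤ (size l) h))

subtreeEnd-nested : ∀ T {j k} → j < k → k < size T →
                    k ≤ subtreeEnd T j → subtreeEnd T k ≤ subtreeEnd T j
subtreeEnd-nested (node l r) {j} {k} j<k k<n h with nodePosition (size l) j | nodePosition (size l) k
... | atRoot     | _ rewrite subtreeEnd-root l r = ≤-pred (subtreeEnd<size (node l r) k k<n)
... | inLeft q   | inLeft q' rewrite subtreeEnd-left l r q' | subtreeEnd-left l r q = subtreeEnd-nested l j<k q' h
... | inLeft q   | atRoot rewrite subtreeEnd-left l r q = ⊥-elim (<⇒≱ (subtreeEnd<size l j q) h)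
... | inLeft q   | inRight k' rewrite subtreeEnd-left l r q =
  ⊥-elim (<⇒≱ (subtreeEnd<size l j q) (≤-trans (m≤n⇒m≤1+n (m≤m+n (size l) k')) h))
... | inRight j' | inLeft q' = ⊥-elim (left-of-right (size l) j' (<⇒≤ q') j<k)
... | inRight j' | atRoot = ⊥-elim (left-of-right (size l) j' ≤-refl j<k)
... | inRight j' | inRight k' rewrite subtreeEnd-right l r k' | subtreeEnd-right l r j' =
  suc-+-monoʳ-≤ (size l) (subtreeEnd-nested r (suc-+-cancelˡ-< (size l) j<k) (suc-+-cancelˡ-< (size l) k<n)
                                              (suc-+-cancelˡ-≤ (size l) h))

subtreeStart-right-descendant : ∀ T {j k} → j < k → k < size T →
                                k ≤ subtreeEnd T j → j < subtreeStart T k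
subtreeStart-right-descendant (node l r) {j} {k} j<k k<n h with nodePosition (size l) j | nodePosition (size l) k
... | atRoot     | inLeft q' = ⊥-elim (<⇒≱ j<k (<⇒≤ q'))
... | atRoot     | atRoot = ⊥-elim (<-irrefl refl j<k)
... | atRoot     | inRight k' rewrite subtreeStart-right l r (suc-+-cancelˡ-< (size l) k<n) = m<suc[m+n] (size l) _
... | inLeft q   | inLeft q' rewrite subtreeStart-left l r q' | subtreeEnd-left l r q =
  subtreeStart-right-descendant l j<k q' h
... | inLeft q   | atRoot rewrite subtreeEnd-left l r q = ⊥-elim (<⇒≱ (subtreeEnd<size l j q) h)
... | inLeft q   | inRight k' rewrite subtreeEnd-left l r q =
  ⊥-elim (<⇒≱ (subtreeEnd<size l j q) (≤-trans (m≤n⇒m≤1+n (m≤m+n (size l) k')) h))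
... | inRight j' | inLeft q' = ⊥-elim (left-of-right (size l) j' (<⇒≤ q') j<k)
... | inRight j' | atRoot = ⊥-elim (left-of-right (size l) j' ≤-refl j<k)
... | inRight j' | inRight k' rewrite subtreeStart-right l r (suc-+-cancelˡ-< (size l) k<n) | subtreeEnd-right l r j' =
  suc-+-monoʳ-< (size l) (subtreeStart-right-descendant r (suc-+-cancelˡ-< (size l) j<k)
                           (suc-+-cancelˡ-< (size l) k<n) (suc-+-cancelˡ-≤ (size l) h))

-- The node just after the subtree of v_j is an ancestor of v_j, reached from its left subtree.
subtreeStart-after-subtree : ∀ T j → suc (subtreeEnd T j) < size T →
                             subtreeStart T (suc (subtreeEnd T j)) ≤ j
subtreeStart-after-subtree (node l r) j h with nodePosition (size l) j
... | atRoot rewrite subtreeEnd-root l r = ⊥-elim (<-irrefl refl (≤-pred h))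
... | inLeft q rewrite subtreeEnd-left l r q with m≤n⇒m<n∨m≡n (subtreeEnd<size l j q)
...   | inj₁ lt rewrite subtreeStart-left l r lt = subtreeStart-after-subtree l j lt
...   | inj₂ eq rewrite eq | subtreeStart-root l r = z≤n
subtreeStart-after-subtree (node l r) j h | inRight j'
  rewrite subtreeEnd-right l r j' | sym (+-suc (size l) (subtreeEnd r j')) =
  subst (_≤ suc (size l + j')) (sym (subtreeStart-right l r h'))
        (suc-+-monoʳ-≤ (size l) (subtreeStart-after-subtree r j' h'))
  where
  h' : suc (subtreeEnd r j') < size r
  h' = suc-+-cancelˡ-< (size l) h

-- φ n T T' is a meandering diagram

module Arcs (n : ℕ) (T T' : Tree) where

  upperArc : ∀ {k} → k < n → φ n T T' upper (2 * subtreeStart T' k) (suc (2 * k))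
  upperArc {k} p = suc k , s≤s z≤n , p , refl , sym (2*suc∸1 k)

  upperArc⁻ : ∀ {i j} → φ n T T' upper i j →
              Σ ℕ λ k → k < n × i ≡ 2 * subtreeStart T' k × j ≡ suc (2 * k)
  upperArc⁻ (suc k , _ , p , refl , refl) = k , p , refl , 2*suc∸1 k

  lowerArc : ∀ {k} → k < n → φ n T T' lower (suc (2 * k)) (2 * suc (subtreeEnd T k))
  lowerArc {k} p = suc k , s≤s z≤n , p , sym (2*suc∸1 k) , refl

  lowerArc⁻ : ∀ {i j} → φ n T T' lower i j →
              Σ ℕ λ k → k < n × i ≡ suc (2 * k) × j ≡ 2 * suc (subtreeEnd T k)
  lowerArc⁻ (suc k , _ , p , refl , refl) = k , p , 2*suc∸1 k , refl

module _ (n : ℕ) {T T' : Tree} (sT : size T ≡ n) (sT' : size T' ≡ n) where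
  open Arcs n T T'
  private
    D = φ n T T'
    <sizeT : ∀ {k} → k < n → k < size T
    <sizeT = subst (_ <_) (sym sT)
    <sizeT' : ∀ {k} → k < n → k < size T'
    <sizeT' = subst (_ <_) (sym sT')

  φ-isArcDiagram : IsArcDiagram n D
  φ-isArcDiagram upper i j a with upperArc⁻ a
  ... | k , k<n , refl , refl = s≤s (double-mono-≤ (subtreeStart≤ T' k)) , <⇒odd≤even k<n
  φ-isArcDiagram lower i j a with lowerArc⁻ a
  ... | k , k<n , refl , refl =
    subst (_≤ 2 * suc (subtreeEnd T k)) (*-suc 2 k) (double-mono-≤ (s≤s (≤subtreeEnd T k))) ,
    double-mono-≤ (subst (_ <_) sT (subtreeEnd<size T k (<sizeT k<n)))

  φ-nonCrossing : NonCrossing D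
  φ-nonCrossing upper _ _ _ _ a b (h₁ , h₂ , h₃) with upperArc⁻ a | upperArc⁻ b
  ... | j , _ , refl , refl | k , k<n , refl , refl =
    <⇒≱ (double-cancel-< h₁) (subtreeStart-nested T' (odd<odd⇒< h₃) (<sizeT' k<n) (even<odd⇒≤ h₂))
  φ-nonCrossing lower _ _ _ _ a b (h₁ , h₂ , h₃) with lowerArc⁻ a | lowerArc⁻ b
  ... | j , _ , refl , refl | k , k<n , refl , refl =
    <⇒≱ (≤-pred (double-cancel-< h₃))
        (subtreeEnd-nested T (odd<odd⇒< h₁) (<sizeT k<n) (≤-pred (odd≤even⇒< (<⇒≤ h₂))))

  φ-upperEnds : ∀ i j → D upper i j → Black i × White j
  φ-upperEnds i j a with upperArc⁻ a
  ... | k , _ , refl , refl = (subtreeStart T' k , refl) , (k , refl)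

  φ-lowerEnds : ∀ i j → D lower i j → White i × Black j
  φ-lowerEnds i j a with lowerArc⁻ a
  ... | k , _ , refl , refl = (k , refl) , (suc (subtreeEnd T k) , refl)

  φ-whiteUpper : ∀ w → White w → w ≤ 2 * n → ExactlyOneArc D upper w
  φ-whiteUpper _ (m , refl) w≤ = arc , upperArc (odd≤even⇒< w≤) , inj₂ refl , unique
    where
    arc = (2 * subtreeStart T' m , suc (2 * m))
    unique : ∀ b → D upper (proj₁ b) (proj₂ b) → Incident (suc (2 * m)) b → b ≡ arc
    unique _ a inc with upperArc⁻ a
    unique _ a (inj₁ e) | k , _ , refl , refl = ⊥-elim (even≢odd (subtreeStart T' k) m e)
    unique _ a (inj₂ e) | k , _ , refl , refl with odd-injective {k} {m} e
    ... | refl = refl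

  φ-whiteLower : ∀ w → White w → w ≤ 2 * n → ExactlyOneArc D lower w
  φ-whiteLower _ (m , refl) w≤ = arc , lowerArc (odd≤even⇒< w≤) , inj₁ refl , unique
    where
    arc = (suc (2 * m) , 2 * suc (subtreeEnd T m))
    unique : ∀ b → D lower (proj₁ b) (proj₂ b) → Incident (suc (2 * m)) b → b ≡ arc
    unique _ a inc with lowerArc⁻ a
    unique _ a (inj₂ e) | k , _ , refl , refl = ⊥-elim (even≢odd (suc (subtreeEnd T k)) m e)
    unique _ a (inj₁ e) | k , _ , refl , refl with odd-injective {k} {m} e
    ... | refl = refl

  φ-meandering : Meandering n D
  φ-meandering = record
    { arcDiagram = φ-isArcDiagram ; nonCrossing = φ-nonCrossing
    ; upperEnds = φ-upperEnds ; lowerEnds = φ-lowerEnds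
    ; whiteUpper = φ-whiteUpper ; whiteLower = φ-whiteLower }

-- Injectivity of φ

Agree : (Tree → ℕ → ℕ) → Tree → Tree → Set
Agree f T₁ T₂ = ∀ k → k < size T₁ → f T₁ k ≡ f T₂ k

RealisedOn : (Tree → ℕ → ℕ) → (ℕ → ℕ) → ℕ → Tree → Set
RealisedOn f g lo t = ∀ k → k < size t → lo + f t k ≡ g (lo + k)

module PositionStatistic (f : Tree → ℕ → ℕ)
  (f-left  : ∀ l r {k} → k < size l → f (node l r) k ≡ f l k)
  (f-right : ∀ l r {k} → k < size r → f (node l r) (suc (size l + k)) ≡ suc (size l + f r k))
  where

  module _ (f-root : ∀ {l₁ r₁ l₂ r₂} → size l₁ < size l₂ →
                     size (node l₁ r₁) ≡ size (node l₂ r₂) → ¬ Agree f (node l₁ r₁) (node l₂ r₂)) where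

    private
      leftSize-agree : ∀ {l₁ r₁ l₂ r₂} → size (node l₁ r₁) ≡ size (node l₂ r₂) →
                       Agree f (node l₁ r₁) (node l₂ r₂) → size l₁ ≡ size l₂
      leftSize-agree {l₁} {r₁} {l₂} {r₂} s agree with <-cmp (size l₁) (size l₂)
      ... | tri< lt _ _ = ⊥-elim (f-root lt s agree)
      ... | tri≈ _ eq _ = eq
      ... | tri> _ _ gt = ⊥-elim (f-root gt (sym s) λ k p → sym (agree k (subst (k <_) (sym s) p)))

    determines-tree : ∀ T₁ T₂ → size T₁ ≡ size T₂ → Agree f T₁ T₂ → T₁ ≡ T₂
    determines-tree leaf leaf _ _ = refl
    determines-tree (node l₁ r₁) (node l₂ r₂) s agree =
      cong₂ node (determines-tree l₁ l₂ eqˡ agreeˡ) (determines-tree r₁ r₂ eqʳ agreeʳ)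
      where
      open ≡-Reasoning
      eqˡ : size l₁ ≡ size l₂
      eqˡ = leftSize-agree s agree
      eqʳ : size r₁ ≡ size r₂
      eqʳ = +-cancelˡ-≡ (size l₁) _ _ (suc-injective (trans s (cong (λ m → suc (m + size r₂)) (sym eqˡ))))
      agreeˡ : Agree f l₁ l₂
      agreeˡ k p = begin
        f l₁ k             ≡⟨ sym (f-left l₁ r₁ p) ⟩
        f (node l₁ r₁) k   ≡⟨ agree k (<-trans p (m<suc[m+n] (size l₁) (size r₁))) ⟩
        f (node l₂ r₂) k   ≡⟨ f-left l₂ r₂ (subst (k <_) eqˡ p) ⟩
        f l₂ k             ∎
      agreeʳ : Agree f r₁ r₂
      agreeʳ k p = +-cancelˡ-≡ (size l₁) _ _ (suc-injective (begin
        suc (size l₁ + f r₁ k)               ≡⟨ sym (f-right l₁ r₁ p) ⟩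
        f (node l₁ r₁) (suc (size l₁ + k))   ≡⟨ agree _ (suc-+-monoʳ-< (size l₁) p) ⟩
        f (node l₂ r₂) (suc (size l₁ + k))   ≡⟨ cong (λ m → f (node l₂ r₂) (suc (m + k))) eqˡ ⟩
        f (node l₂ r₂) (suc (size l₂ + k))   ≡⟨ f-right l₂ r₂ (subst (k <_) eqʳ p) ⟩
        suc (size l₂ + f r₂ k)               ≡⟨ cong (λ m → suc (m + f r₂ k)) (sym eqˡ) ⟩
        suc (size l₁ + f r₂ k)               ∎))

  realisedOn-node : ∀ {g lo l r} → RealisedOn f g lo l → lo + f (node l r) (size l) ≡ g (lo + size l) →
                    RealisedOn f g (suc (lo + size l)) r → RealisedOn f g lo (node l r)
  realisedOn-node {g} {lo} {l} {r} hˡ hᵐ hʳ k p with nodePosition (size l) k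
  ... | inLeft q rewrite f-left l r q = hˡ k q
  ... | atRoot = hᵐ
  ... | inRight k' = begin
    lo + f (node l r) (suc (size l + k')) ≡⟨ cong (lo +_) (f-right l r k'<) ⟩
    lo + suc (size l + f r k')            ≡⟨ sym (suc[m+n]+o≡m+suc[n+o] lo (size l) _) ⟩
    suc (lo + size l) + f r k'            ≡⟨ hʳ k' k'< ⟩
    g (suc (lo + size l) + k')            ≡⟨ cong g (suc[m+n]+o≡m+suc[n+o] lo (size l) k') ⟩
    g (lo + suc (size l + k'))            ∎
    where
    open ≡-Reasoning
    k'< : k' < size r
    k'< = suc-+-cancelˡ-< (size l) p

subtreeStart-right-positive : ∀ l r {k} → size l < k → k < size (node l r) → 0 < subtreeStart (node l r) k
subtreeStart-right-positive l r {k} l<k k<n with nodePosition (size l) k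
... | inLeft q   = ⊥-elim (<-asym l<k q)
... | atRoot     = ⊥-elim (<-irrefl refl l<k)
... | inRight k' rewrite subtreeStart-right l r (suc-+-cancelˡ-< (size l) k<n) = s≤s z≤n

module StartStatistic = PositionStatistic subtreeStart subtreeStart-left subtreeStart-right
module EndStatistic = PositionStatistic subtreeEnd subtreeEnd-left (λ l r {k} _ → subtreeEnd-right l r k)

subtreeStart-injective : ∀ T₁ T₂ → size T₁ ≡ size T₂ → Agree subtreeStart T₁ T₂ → T₁ ≡ T₂
subtreeStart-injective = StartStatistic.determines-tree root
  where
  root : ∀ {l₁ r₁ l₂ r₂} → size l₁ < size l₂ → size (node l₁ r₁) ≡ size (node l₂ r₂) →
         ¬ Agree subtreeStart (node l₁ r₁) (node l₂ r₂)
  root {l₁} {r₁} {l₂} {r₂} lt s agree = <⇒≢ (subtreeStart-right-positive l₁ r₁ lt l₂<n)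
    (sym (trans (agree (size l₂) l₂<n) (subtreeStart-root l₂ r₂)))
    where
    l₂<n : size l₂ < size (node l₁ r₁)
    l₂<n = subst (size l₂ <_) (sym s) (m<suc[m+n] (size l₂) (size r₂))

subtreeEnd-injective : ∀ T₁ T₂ → size T₁ ≡ size T₂ → Agree subtreeEnd T₁ T₂ → T₁ ≡ T₂
subtreeEnd-injective = EndStatistic.determines-tree root
  where
  root : ∀ {l₁ r₁ l₂ r₂} → size l₁ < size l₂ → size (node l₁ r₁) ≡ size (node l₂ r₂) →
         ¬ Agree subtreeEnd (node l₁ r₁) (node l₂ r₂)
  root {l₁} {r₁} {l₂} {r₂} lt s agree =
    <-irrefl (trans (sym (agree (size l₁) (m<suc[m+n] _ _))) (subtreeEnd-root l₁ r₁)) (begin-strict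
      subtreeEnd (node l₂ r₂) (size l₁) ≡⟨ subtreeEnd-left l₂ r₂ lt ⟩
      subtreeEnd l₂ (size l₁)           <⟨ subtreeEnd<size l₂ (size l₁) lt ⟩
      size l₂                           ≤⟨ ≤-pred (subst (suc (size l₂) ≤_) (sym s) (m<suc[m+n] _ _)) ⟩
      size l₁ + size r₁                 ∎)
    where open ≤-Reasoning

φ-injective : ∀ n {T₁ T₁' T₂ T₂'} →
              size T₁ ≡ n → size T₁' ≡ n → size T₂ ≡ n → size T₂' ≡ n →
              φ n T₁ T₁' ≈D φ n T₂ T₂' → (T₁ ≡ T₂) × (T₁' ≡ T₂')
φ-injective n {T₁} {T₁'} {T₂} {T₂'} s₁ s₁' s₂ s₂' eqv =
  subtreeEnd-injective T₁ T₂ (trans s₁ (sym s₂)) (λ k p → sameEnd (subst (k <_) s₁ p)) ,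
  subtreeStart-injective T₁' T₂' (trans s₁' (sym s₂')) (λ k p → sameStart (subst (k <_) s₁' p))
  where
  module A₁ = Arcs n T₁ T₁'
  module A₂ = Arcs n T₂ T₂'

  sameStart : ∀ {k} → k < n → subtreeStart T₁' k ≡ subtreeStart T₂' k
  sameStart {k} p with A₂.upperArc⁻ (Equivalence.to (eqv upper _ _) (A₁.upperArc p))
  ... | k' , _ , eᵢ , eⱼ with odd-injective {k} {k'} eⱼ
  ... | refl = double-injective eᵢ

  sameEnd : ∀ {k} → k < n → subtreeEnd T₁ k ≡ subtreeEnd T₂ k
  sameEnd {k} p with A₂.lowerArc⁻ (Equivalence.to (eqv lower _ _) (A₁.lowerArc p))
  ... | k' , _ , eᵢ , eⱼ with odd-injective {k} {k'} eᵢ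
  ... | refl = suc-injective (double-injective eⱼ)

-- Surjectivity of φ onto meandering diagrams

-- Every function with the properties of subtreeStart (bounded and nested) is subtreeStart of a tree;
-- the root of an interval is the last position whose subtree starts at the beginning of the interval.
module StartTree (n : ℕ) (c : ℕ → ℕ) (c≤ : ∀ {k} → k < n → c k ≤ k)
                 (c-nested : ∀ {j k} → j < k → k < n → c k ≤ j → c k ≤ c j) where

  Fits : ℕ → ℕ → Set
  Fits lo len = lo + len ≤ n × (∀ d → d < len → lo ≤ c (lo + d))

  c-first : ∀ {lo L} → Fits lo (suc L) → c (lo + 0) ≡ lo
  c-first {lo} (bound , above) =
    ≤-antisym (≤-trans (c≤ (<-≤-trans (+-monoʳ-< lo (s≤s z≤n)) bound)) (≤-reflexive (+-identityʳ lo)))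
              (above 0 (s≤s z≤n))

  fits-left : ∀ {lo p q} → Fits lo (suc (p + q)) → Fits lo p
  fits-left {lo} {p} {q} (bound , above) =
    ≤-trans (+-monoʳ-≤ lo (m≤n⇒m≤1+n (m≤m+n p q))) bound ,
    λ d d<p → above d (m≤n⇒m≤1+n (≤-trans d<p (m≤m+n p q)))

  fits-right : ∀ {lo p q} → Fits lo (suc (p + q)) → c (lo + p) ≡ lo →
               (∀ d → p < d → d ≤ p + q → c (lo + d) ≢ lo) → Fits (suc (lo + p)) q
  fits-right {lo} {p} {q} (bound , above) root last =
    subst (_≤ n) (sym (suc[m+n]+o≡m+suc[n+o] lo p q)) bound , aboveʳ
    where
    aboveʳ : ∀ d → d < q → suc (lo + p) ≤ c (suc (lo + p) + d)
    aboveʳ d d<q with suc (lo + p) ≤? c (suc (lo + p) + d)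
    ... | yes ok = ok
    ... | no ¬ok = ⊥-elim (last (suc (p + d)) (m<suc[m+n] p d) (+-monoʳ-< p d<q) c≡lo)
      where
      k≡ : suc (lo + p) + d ≡ lo + suc (p + d)
      k≡ = suc[m+n]+o≡m+suc[n+o] lo p d
      k<n : suc (lo + p) + d < n
      k<n = <-≤-trans (subst (_< lo + suc (p + q)) (sym k≡) (+-monoʳ-< lo (s≤s (+-monoʳ-< p d<q)))) bound
      c≡lo : c (lo + suc (p + d)) ≡ lo
      c≡lo = subst (λ k → c k ≡ lo) k≡
        (≤-antisym (≤-trans (c-nested (m<suc[m+n] (lo + p) d) k<n (≤-pred (≰⇒> ¬ok))) (≤-reflexive root))
                   (subst (λ k → lo ≤ c k) (sym k≡) (above (suc (p + d)) (s≤s (+-monoʳ-< p d<q)))))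

  startTree : ∀ {len} → Acc _<_ len → ∀ lo → Fits lo len →
              Σ Tree λ t → size t ≡ len × RealisedOn subtreeStart c lo t
  startTree {zero} _ lo _ = leaf , refl , λ _ ()
  startTree {suc L} (acc rec) lo fits with greatestWitness (λ q → c (lo + q) ≟ lo) (c-first fits) L
  ... | p , p≤L , root , last with split≤ p≤L
  ... | q , refl with startTree (rec (s≤s p≤L)) lo (fits-left fits)
                    | startTree (rec (s≤s (m≤n+m q p))) (suc (lo + p)) (fits-right fits root last)
  ... | l , refl , hˡ | r , refl , hʳ =
    node l r , refl ,
    StartStatistic.realisedOn-node {g = c} hˡ
      (trans (cong (lo +_) (subtreeStart-root l r)) (trans (+-identityʳ lo) (sym root))) hʳ

-- Dually for subtreeEnd: the root is the first position whose subtree ends at the end of the interval.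
module EndTree (n : ℕ) (e : ℕ → ℕ) (≤e : ∀ {k} → k < n → k ≤ e k)
               (e-nested : ∀ {j k} → j < k → k < n → k ≤ e j → e k ≤ e j) where

  Fits : ℕ → ℕ → Set
  Fits lo len = lo + len ≤ n × (∀ d → d < len → e (lo + d) < lo + len)

  e-last : ∀ {lo L} → Fits lo (suc L) → e (lo + L) ≡ lo + L
  e-last {lo} {L} (bound , below) =
    ≤-antisym (≤-pred (subst (e (lo + L) <_) (+-suc lo L) (below L ≤-refl)))
              (≤e (subst (_≤ n) (+-suc lo L) bound))

  fits-left : ∀ {lo p q} → Fits lo (suc (p + q)) → e (lo + p) ≡ lo + (p + q) →
              (∀ d → d < p → e (lo + d) ≢ lo + (p + q)) → Fits lo p
  fits-left {lo} {p} {q} (bound , below) root first =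
    ≤-trans (+-monoʳ-≤ lo (m≤n⇒m≤1+n (m≤m+n p q))) bound , belowˡ
    where
    belowˡ : ∀ d → d < p → e (lo + d) < lo + p
    belowˡ d d<p with lo + p ≤? e (lo + d)
    ... | no ¬ok = ≰⇒> ¬ok
    ... | yes ok = ⊥-elim (first d d<p (≤-antisym e≤ (subst (_≤ e (lo + d)) root e-nested′)))
      where
      p≤ : p ≤ suc (p + q)
      p≤ = m≤n⇒m≤1+n (m≤m+n p q)
      e-nested′ : e (lo + p) ≤ e (lo + d)
      e-nested′ = e-nested (+-monoʳ-< lo d<p) (<-≤-trans (+-monoʳ-< lo (s≤s (m≤m+n p q))) bound) ok
      e≤ : e (lo + d) ≤ lo + (p + q)
      e≤ = ≤-pred (subst (e (lo + d) <_) (+-suc lo (p + q)) (below d (≤-trans d<p p≤)))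

  fits-right : ∀ {lo p q} → Fits lo (suc (p + q)) → Fits (suc (lo + p)) q
  fits-right {lo} {p} {q} (bound , below) =
    subst (_≤ n) end≡ bound ,
    λ d d<q → subst₂ _<_ (cong e (sym (suc[m+n]+o≡m+suc[n+o] lo p d))) end≡
                         (below (suc (p + d)) (s≤s (+-monoʳ-< p d<q)))
    where
    end≡ : lo + suc (p + q) ≡ suc (lo + p) + q
    end≡ = sym (suc[m+n]+o≡m+suc[n+o] lo p q)

  endTree : ∀ {len} → Acc _<_ len → ∀ lo → Fits lo len →
            Σ Tree λ t → size t ≡ len × RealisedOn subtreeEnd e lo t
  endTree {zero} _ lo _ = leaf , refl , λ _ ()
  endTree {suc L} (acc rec) lo fits with leastWitness (λ q → e (lo + q) ≟ lo + L) L (e-last fits)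
  ... | p , p≤L , root , first with split≤ p≤L
  ... | q , refl with endTree (rec (s≤s p≤L)) lo (fits-left fits root first)
                    | endTree (rec (s≤s (m≤n+m q p))) (suc (lo + p)) (fits-right fits)
  ... | l , refl , hˡ | r , refl , hʳ =
    node l r , refl ,
    EndStatistic.realisedOn-node {g = e} hˡ (trans (cong (lo +_) (subtreeEnd-root l r)) (sym root)) hʳ

exactlyOneArc-unique : ∀ {D s w i j i' j'} → ExactlyOneArc D s w →
                       D s i j → Incident w (i , j) → D s i' j' → Incident w (i' , j') → (i , j) ≡ (i' , j')
exactlyOneArc-unique (_ , _ , _ , unique) a inc a' inc' = trans (unique _ a inc) (sym (unique _ a' inc'))

-- A meandering diagram is φ of the trees whose subtree starts, resp. ends, are read off its
-- upper, resp. lower, arcs.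
module FromMeandering {n : ℕ} {D : ArcDiagram} (M : Meandering n D) where
  open Meandering M

  upperArcAt : ∀ {k} → k < n → Σ ℕ λ c → c ≤ k × D upper (2 * c) (suc (2 * k))
  upperArcAt {k} k<n with whiteUpper (suc (2 * k)) (k , refl) (<⇒odd≤even k<n)
  ... | (i , j) , arc , inc , _ with upperEnds i j arc | arcDiagram upper i j arc | inc
  ... | (c , refl) , _ | _       | inj₁ e    = ⊥-elim (even≢odd c k e)
  ... | (c , refl) , _ | i<j , _ | inj₂ refl = c , even<odd⇒≤ i<j , arc

  lowerArcAt : ∀ {k} → k < n → Σ ℕ λ e → k ≤ e × e < n × D lower (suc (2 * k)) (2 * suc e)
  lowerArcAt {k} k<n with whiteLower (suc (2 * k)) (k , refl) (<⇒odd≤even k<n)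
  ... | (i , j) , arc , inc , _ with lowerEnds i j arc | arcDiagram lower i j arc | inc
  ... | _ , (d , refl)     | _        | inj₂ e    = ⊥-elim (even≢odd d k e)
  ... | _ , (zero , refl)  | () , _   | inj₁ refl
  ... | _ , (suc e , refl) | i<j , j≤ | inj₁ refl =
    e , ≤-pred (odd≤even⇒< (<⇒≤ i<j)) , double-cancel-≤ j≤ , arc

  opaque
    c e : ℕ → ℕ
    c = boundedChoice upperArcAt
    e = boundedChoice lowerArcAt

    c≤ : ∀ {k} → k < n → c k ≤ k
    c≤ k<n = proj₁ (boundedChoice-spec upperArcAt k<n)

    upperArc-c : ∀ {k} → k < n → D upper (2 * c k) (suc (2 * k))
    upperArc-c k<n = proj₂ (boundedChoice-spec upperArcAt k<n)

    ≤e : ∀ {k} → k < n → k ≤ e k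
    ≤e k<n = proj₁ (boundedChoice-spec lowerArcAt k<n)

    e<n : ∀ {k} → k < n → e k < n
    e<n k<n = proj₁ (proj₂ (boundedChoice-spec lowerArcAt k<n))

    lowerArc-e : ∀ {k} → k < n → D lower (suc (2 * k)) (2 * suc (e k))
    lowerArc-e k<n = proj₂ (proj₂ (boundedChoice-spec lowerArcAt k<n))

  c-nested : ∀ {j k} → j < k → k < n → c k ≤ j → c k ≤ c j
  c-nested {j} {k} j<k k<n ck≤j with c k ≤? c j
  ... | yes ok = ok
  ... | no ¬ok = ⊥-elim (nonCrossing upper _ _ _ _ (upperArc-c (<-trans j<k k<n)) (upperArc-c k<n)
                   (*-monoʳ-< 2 (≰⇒> ¬ok) , s≤s (double-mono-≤ ck≤j) , s≤s (*-monoʳ-< 2 j<k)))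

  e-nested : ∀ {j k} → j < k → k < n → k ≤ e j → e k ≤ e j
  e-nested {j} {k} j<k k<n k≤ej with e k ≤? e j
  ... | yes ok = ok
  ... | no ¬ok = ⊥-elim (nonCrossing lower _ _ _ _ (lowerArc-e (<-trans j<k k<n)) (lowerArc-e k<n)
                   (s≤s (*-monoʳ-< 2 j<k) ,
                    subst (suc (suc (2 * k)) ≤_) (sym (*-suc 2 (e j))) (s≤s (s≤s (double-mono-≤ k≤ej))) ,
                    *-monoʳ-< 2 (s≤s (≰⇒> ¬ok))))

  startTree : Σ Tree λ t → size t ≡ n × RealisedOn subtreeStart c 0 t
  startTree = StartTree.startTree n c c≤ c-nested (<-wellFounded n) 0 (≤-refl , λ _ _ → z≤n)

  endTree : Σ Tree λ t → size t ≡ n × RealisedOn subtreeEnd e 0 t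
  endTree = EndTree.endTree n e ≤e e-nested (<-wellFounded n) 0 (≤-refl , λ _ → e<n)

  T T' : Tree
  T = proj₁ endTree
  T' = proj₁ startTree

  subtreeStart≡c : ∀ {k} → k < n → subtreeStart T' k ≡ c k
  subtreeStart≡c {k} k<n = proj₂ (proj₂ startTree) k (subst (k <_) (sym (proj₁ (proj₂ startTree))) k<n)

  subtreeEnd≡e : ∀ {k} → k < n → subtreeEnd T k ≡ e k
  subtreeEnd≡e {k} k<n = proj₂ (proj₂ endTree) k (subst (k <_) (sym (proj₁ (proj₂ endTree))) k<n)

  open Arcs n T T'

  φ≈D : φ n T T' ≈D D
  φ≈D upper i j = mk⇔ to from
    where
    to : φ n T T' upper i j → D upper i j
    to a with upperArc⁻ a
    ... | k , k<n , refl , refl =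
      subst (λ m → D upper (2 * m) (suc (2 * k))) (sym (subtreeStart≡c k<n)) (upperArc-c k<n)
    from : D upper i j → φ n T T' upper i j
    from a with upperEnds i j a | arcDiagram upper i j a
    ... | _ , (k , refl) | _ , j≤ = subst (λ i → φ n T T' upper i (suc (2 * k))) i≡ (upperArc k<n)
      where
      k<n : k < n
      k<n = odd≤even⇒< j≤
      i≡ : 2 * subtreeStart T' k ≡ i
      i≡ = trans (cong (2 *_) (subtreeStart≡c k<n))
             (cong proj₁ (exactlyOneArc-unique {D = D} (whiteUpper _ (k , refl) j≤)
                                               (upperArc-c k<n) (inj₂ refl) a (inj₂ refl)))
  φ≈D lower i j = mk⇔ to from
    where
    to : φ n T T' lower i j → D lower i j
    to a with lowerArc⁻ a
    ... | k , k<n , refl , refl =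
      subst (λ m → D lower (suc (2 * k)) (2 * suc m)) (sym (subtreeEnd≡e k<n)) (lowerArc-e k<n)
    from : D lower i j → φ n T T' lower i j
    from a with lowerEnds i j a | arcDiagram lower i j a
    ... | (k , refl) , _ | i<j , j≤ = subst (φ n T T' lower (suc (2 * k))) j≡ (lowerArc k<n)
      where
      k<n : k < n
      k<n = odd≤even⇒< (≤-trans (<⇒≤ i<j) j≤)
      j≡ : 2 * suc (subtreeEnd T k) ≡ j
      j≡ = trans (cong (λ m → 2 * suc m) (subtreeEnd≡e k<n))
             (cong proj₂ (exactlyOneArc-unique {D = D} (whiteLower _ (k , refl) (<⇒odd≤even k<n))
                                               (lowerArc-e k<n) (inj₁ refl) a (inj₁ refl)))

  φ-surjective : Σ Tree λ T₀ → Σ Tree λ T₀' → size T₀ ≡ n × size T₀' ≡ n × (φ n T₀ T₀' ≈D D)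
  φ-surjective = T , T' , proj₁ (proj₂ endTree) , proj₁ (proj₂ startTree) , φ≈D

-- The Tamari order through right subtree sizes

_≤ᵃ_ : Tree → Tree → Set
T ≤ᵃ T' = infixSizes T ≤₂* infixSizes T'

≤ᵃ⇒size≡ : ∀ {T T'} → T ≤ᵃ T' → size T ≡ size T'
≤ᵃ⇒size≡ {T} {T'} le = trans (sym (length-infixSizes T)) (trans (Pointwise-length le) (length-infixSizes T'))

≤ᵃ⇒rightSize≤ : ∀ {T T'} → T ≤ᵃ T' → ∀ k → rightSize T k ≤ rightSize T' k
≤ᵃ⇒rightSize≤ = ≤₂*⇒nth≤

rightSize≤⇒≤ᵃ : ∀ {T T'} → size T ≡ size T' →
                (∀ k → k < size T → rightSize T k ≤ rightSize T' k) → T ≤ᵃ T'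
rightSize≤⇒≤ᵃ {T} {T'} s le =
  nth≤⇒≤₂* (trans (length-infixSizes T) (trans s (sym (length-infixSizes T'))))
           (λ k p → le k (subst (k <_) (length-infixSizes T) p))

-- A right rotation only enlarges the right subtree of the rotated node.
⟶⇒≤ᵃ : ∀ {T T'} → T ⟶ T' → T ≤ᵃ T'
⟶⇒≤ᵃ (rot {A} {B} {C}) =
  subst (λ xs → xs ≤₂* (infixSizes (node A (node B C))))
        (sym (++-assoc (infixSizes A) ((size A , size B) ∷ infixSizes B) ((size (node A B) , size C) ∷ infixSizes C)))
        (++⁺ ≤₂*-refl (m≤n⇒m≤1+n (m≤m+n (size B) (size C)) ∷ ++⁺ ≤₂*-refl (≤-refl ∷ ≤₂*-refl)))
⟶⇒≤ᵃ (left ρ) = ++⁺ (⟶⇒≤ᵃ ρ) (≤-refl ∷ ≤₂*-refl)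
⟶⇒≤ᵃ (right ρ) = ++⁺ ≤₂*-refl (≤-reflexive (≤ᵃ⇒size≡ (⟶⇒≤ᵃ ρ)) ∷ ⟶⇒≤ᵃ ρ)

≤T⇒≤ᵃ : ∀ {T T'} → T ≤T T' → T ≤ᵃ T'
≤T⇒≤ᵃ ε = ≤₂*-refl
≤T⇒≤ᵃ (ρ ◅ ρs) = ≤₂*-trans (⟶⇒≤ᵃ ρ) (≤T⇒≤ᵃ ρs)

≤T-node : ∀ {A A' B B'} → A ≤T A' → B ≤T B' → node A B ≤T node A' B'
≤T-node {A' = A'} {B = B} le le' = gmap (λ t → node t B) left le ◅◅ gmap (node A') right le'

-- If no subtree rooted before position k reaches k, rotating along the left branch makes the
-- first k positions a left subtree, while the right sizes of the later positions can only grow.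
rotate-prefix : ∀ T k → k < size T → (∀ j → j < k → subtreeEnd T j < k) →
                Σ Tree λ A → Σ Tree λ B → Σ (ℕ × ℕ) λ x → Σ (List (ℕ × ℕ)) λ rest →
                T ≤T node A B × size A ≡ k × infixSizes T ≡ infixSizes A ++ x ∷ rest × infixSizes B ≤₂* rest
rotate-prefix (node l r) k k<n closed with nodePosition (size l) k
... | atRoot = l , r , (size l , size r) , infixSizes r , ε , refl , refl , ≤₂*-refl
... | inRight k' = ⊥-elim (<⇒≱ (suc-+-cancelˡ-< (size l) k<n) (+-cancelˡ-≤ (size l) _ _ (≤-pred root<k)))
  where
  root<k : size l + size r < suc (size l + k')
  root<k = subst (_< suc (size l + k')) (subtreeEnd-root l r) (closed (size l) (m<suc[m+n] (size l) k'))
... | inLeft q with rotate-prefix l k q (λ j j<k → subst (_< k) (subtreeEnd-left l r (<-trans j<k q)) (closed j j<k))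
...   | A , B , x , rest , l≤ , refl , infix≡ , B≤ =
  A , node B r , x , rest ++ (size l , size r) ∷ infixSizes r ,
  gmap (λ t → node t r) left l≤ ◅◅ (rot ◅ ε) , refl ,
  trans (cong (_++ (size l , size r) ∷ infixSizes r) infix≡) (++-assoc (infixSizes A) (x ∷ rest) _) ,
  ++⁺ B≤ (≤-refl ∷ ≤₂*-refl)

≤ᵃ⇒≤T : ∀ {T T'} → T ≤ᵃ T' → T ≤T T'
≤ᵃ⇒≤T {leaf} {leaf} _ = ε
≤ᵃ⇒≤T {node l r} {leaf} T≤ with ≤ᵃ⇒size≡ {node l r} {leaf} T≤
... | ()
≤ᵃ⇒≤T {T} {node L R} T≤ with rotate-prefix T (size L) L<n closed
  where
  L<n : size L < size T
  L<n = subst (size L <_) (sym (≤ᵃ⇒size≡ {T} {node L R} T≤)) (m<suc[m+n] (size L) (size R))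
  closed : ∀ j → j < size L → subtreeEnd T j < size L
  closed j j<L = begin-strict
    j + rightSize T j            ≤⟨ +-monoʳ-≤ j (≤ᵃ⇒rightSize≤ {T} {node L R} T≤ j) ⟩
    j + rightSize (node L R) j   ≡⟨ subtreeEnd-left L R j<L ⟩
    subtreeEnd L j               <⟨ subtreeEnd<size L j j<L ⟩
    size L                       ∎
    where open ≤-Reasoning
... | A , B , x , rest , T≤AB , sizeA , infix≡ , B≤ with
      ≤₂*-++⁻ {infixSizes A} {infixSizes L} {x ∷ rest}
              (trans (length-infixSizes A) (trans sizeA (sym (length-infixSizes L))))
              (subst (_≤₂* infixSizes (node L R)) infix≡ T≤)
...   | A≤L , (_ ∷ rest≤R) = T≤AB ◅◅ ≤T-node (≤ᵃ⇒≤T A≤L) (≤ᵃ⇒≤T (≤₂*-trans B≤ rest≤R))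

-- The underlying graph

-- sub is the subtree of T whose infix positions start at o
record SubtreeAt (T sub : Tree) (o : ℕ) : Set where
  field
    infixAt≡ : ∀ {k} → k < size sub → infixAt T (o + k) ≡ infixAt sub k
    bounded  : o + size sub ≤ size T

module _ {T : Tree} where
  open SubtreeAt

  subtreeAt-self : SubtreeAt T T 0
  subtreeAt-self = record { infixAt≡ = λ _ → refl ; bounded = ≤-refl }

  subtreeAt-left : ∀ {l r o} → SubtreeAt T (node l r) o → SubtreeAt T l o
  subtreeAt-left {l} {r} {o} at = record
    { infixAt≡ = λ p → trans (infixAt≡ at (<-trans p (m<suc[m+n] (size l) (size r)))) (infixAt-left l r p)
    ; bounded  = ≤-trans (+-monoʳ-≤ o (m≤n⇒m≤1+n (m≤m+n (size l) (size r)))) (bounded at) }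

  subtreeAt-right : ∀ {l r o} → SubtreeAt T (node l r) o → SubtreeAt T r (suc (o + size l))
  subtreeAt-right {l} {r} {o} at = record
    { infixAt≡ = λ {k} p → trans (cong (infixAt T) (suc[m+n]+o≡m+suc[n+o] o (size l) k))
                                 (trans (infixAt≡ at (suc-+-monoʳ-< (size l) p)) (infixAt-right l r k))
    ; bounded  = subst (_≤ size T) (sym (suc[m+n]+o≡m+suc[n+o] o (size l) (size r))) (bounded at) }

  subtreeAt-rightSize : ∀ {sub o} → SubtreeAt T sub o → ∀ {k} → k < size sub →
                        rightSize T (o + k) ≡ rightSize sub k
  subtreeAt-rightSize at p = cong (maybe proj₂ 0) (infixAt≡ at p)

  subtreeAt-subtreeStart : ∀ {sub o} → SubtreeAt T sub o → ∀ {k} → k < size sub →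
                           subtreeStart T (o + k) ≡ o + subtreeStart sub k
  subtreeAt-subtreeStart {sub} {o} at {k} p =
    trans (cong ((o + k) ∸_) (cong (maybe proj₁ 0) (infixAt≡ at p))) (+-∸-assoc o (leftSize≤ sub k p))

module _ {n : ℕ} {D : ArcDiagram} where

  joins-sym : ∀ {w x y} → Joins n D w x y → Joins n D w y x
  joins-sym (inj₁ e) = inj₂ e
  joins-sym (inj₂ e) = inj₁ e

  walk-++ : ∀ {x y z ps qs} → Walk n D x y ps → Walk n D y z qs → Walk n D x z (ps ++ qs)
  walk-++ nil q = q
  walk-++ (step j w) q = step j (walk-++ w q)

  walk-reverse : ∀ {x y ps} → Walk n D x y ps → ∃ λ qs → Walk n D y x qs
  walk-reverse nil = [] , nil
  walk-reverse (step j w) with walk-reverse w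
  ... | qs , w' = _ , walk-++ w' (step (joins-sym j) nil)

  walk-vertex : ∀ {x z q qs} → Walk n D x z (q ∷ qs) → proj₂ q ≡ x
  walk-vertex (step _ _) = refl

  walk-source : ∀ {P : ℕ → Set} {y z ps} → Walk n D y z ps → All P (map proj₂ ps) → P z → P y
  walk-source nil _ Pz = Pz
  walk-source (step _ _) (Py ∷ _) _ = Py

module _ {n : ℕ} {D E : ArcDiagram} (D⊆E : ∀ s i j → D s i j → E s i j) where

  walk-map : ∀ {x y ps} → Walk n D x y ps → Walk n E x y ps
  walk-map nil = nil
  walk-map (step j w) = step (joins-map j) (walk-map w)
    where
    otherEnd-map : ∀ {s w x} → OtherEnd D s w x → OtherEnd E s w x
    otherEnd-map (inj₁ a) = inj₁ (D⊆E _ _ _ a)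
    otherEnd-map (inj₂ a) = inj₂ (D⊆E _ _ _ a)
    edgeEnds-map : ∀ {w x y} → EdgeEnds n D w x y → EdgeEnds n E w x y
    edgeEnds-map (white , bound , up , lo) = white , bound , otherEnd-map up , otherEnd-map lo
    joins-map : ∀ {w x y} → Joins n D w x y → Joins n E w x y
    joins-map (inj₁ e) = inj₁ (edgeEnds-map e)
    joins-map (inj₂ e) = inj₂ (edgeEnds-map e)

  connected-map : Connected n D → Connected n E
  connected-map C x y vx vy with C x y vx vy
  ... | ps , w = ps , walk-map w

Between : ℕ → ℕ → ℕ → Set
Between lo hi x = Σ ℕ λ v → x ≡ 2 * v × lo ≤ v × v ≤ hi

-- In the underlying graph of φ n T T', the white point k + 1/2 is the edge joining the black points
-- subtreeStart T' k and suc (subtreeEnd T k).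
module Edges (n : ℕ) {T T' : Tree} (sT : size T ≡ n) (sT' : size T' ≡ n) where
  open Arcs n T T'

  D : ArcDiagram
  D = φ n T T'

  EdgeOf : ℕ → ℕ → ℕ → Set
  EdgeOf k x y = (x ≡ 2 * subtreeStart T' k × y ≡ 2 * suc (subtreeEnd T k))
               ⊎ (x ≡ 2 * suc (subtreeEnd T k) × y ≡ 2 * subtreeStart T' k)

  <sizeT : ∀ {k} → k < n → k < size T
  <sizeT = subst (_ <_) (sym sT)

  <sizeT' : ∀ {k} → k < n → k < size T'
  <sizeT' = subst (_ <_) (sym sT')

  edge : ∀ {k} → k < n → Joins n D (suc (2 * k)) (2 * subtreeStart T' k) (2 * suc (subtreeEnd T k))
  edge {k} k<n = inj₁ ((k , refl) , <⇒odd≤even k<n , inj₁ (upperArc k<n) , inj₂ (lowerArc k<n))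

  edgeEnds⁻ : ∀ {w x y} → EdgeEnds n D w x y →
              Σ ℕ λ k → k < n × w ≡ suc (2 * k) × x ≡ 2 * subtreeStart T' k × y ≡ 2 * suc (subtreeEnd T k)
  edgeEnds⁻ ((m , refl) , _ , inj₂ a , _) with upperArc⁻ a
  ... | k , _ , e , _ = ⊥-elim (even≢odd (subtreeStart T' k) m (sym e))
  edgeEnds⁻ ((m , refl) , _ , inj₁ a , inj₁ b) with lowerArc⁻ b
  ... | k , _ , _ , e = ⊥-elim (even≢odd (suc (subtreeEnd T k)) m (sym e))
  edgeEnds⁻ ((m , refl) , _ , inj₁ a , inj₂ b) with upperArc⁻ a | lowerArc⁻ b
  ... | k , k<n , x≡ , w≡ | k' , _ , w≡' , y≡
    with odd-injective {k} {m} (sym w≡) | odd-injective {k'} {m} (sym w≡')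
  ... | refl | refl = k , k<n , refl , x≡ , y≡

  joins⁻ : ∀ {w x y} → Joins n D w x y → Σ ℕ λ k → k < n × w ≡ suc (2 * k) × EdgeOf k x y
  joins⁻ (inj₁ e) with edgeEnds⁻ e
  ... | k , k<n , w≡ , x≡ , y≡ = k , k<n , w≡ , inj₁ (x≡ , y≡)
  joins⁻ (inj₂ e) with edgeEnds⁻ e
  ... | k , k<n , w≡ , x≡ , y≡ = k , k<n , w≡ , inj₂ (y≡ , x≡)

  start<suc[end] : ∀ k → subtreeStart T' k < suc (subtreeEnd T k)
  start<suc[end] k = s≤s (≤-trans (subtreeStart≤ T' k) (≤subtreeEnd T k))

  no-loop : ∀ {w x} → ¬ Joins n D w x x
  no-loop j with joins⁻ j
  ... | k , _ , _ , inj₁ (x≡ , x≡') = <-irrefl (double-injective (trans (sym x≡) x≡')) (start<suc[end] k)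
  ... | k , _ , _ , inj₂ (x≡ , x≡') = <-irrefl (double-injective (trans (sym x≡') x≡)) (start<suc[end] k)

  edge-ends-bounded : ∀ {w x y} → Joins n D w x y → Between 0 n x
  edge-ends-bounded j with joins⁻ j
  ... | k , k<n , _ , inj₁ (refl , _) = _ , refl , z≤n , ≤-trans (subtreeStart≤ T' k) (<⇒≤ k<n)
  ... | k , k<n , _ , inj₂ (refl , _) = _ , refl , z≤n , subst (_ <_) sT (subtreeEnd<size T k (<sizeT k<n))

  walk-vertices-bounded : ∀ {x z ps} → Walk n D x z ps → All (Between 0 n) (map proj₂ ps)
  walk-vertices-bounded nil = []
  walk-vertices-bounded (step j w) = edge-ends-bounded j ∷ walk-vertices-bounded w

SameSide : ℕ → ℕ → ℕ → Set
SameSide c x y = x ≤ c ⇔ y ≤ c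

open IsEquivalence (⇔-isEquivalence {ℓ = 0ℓ}) using ()
  renaming (refl to ⇔-refl; sym to ⇔-sym; trans to ⇔-trans)

-- A closed walk inside In crosses the cut at c an even number of times, so it cannot use ℓ exactly once.
module Cut {n : ℕ} {D : ArcDiagram} (In : ℕ → Set) (c ℓ : ℕ)
  (keeps   : ∀ {w x y} → Joins n D w x y → In x → In y → w ≢ ℓ → SameSide c x y)
  (crosses : ∀ {x y} → Joins n D ℓ x y → ¬ SameSide c x y) where

  avoiding-sameSide : ∀ {x z ps} → Walk n D x z ps → All In (map proj₂ ps) → In z → ℓ ∉ map proj₁ ps →
                      SameSide c x z × All (SameSide c x) (map proj₂ ps)
  avoiding-sameSide nil _ _ _ = ⇔-refl , []
  avoiding-sameSide (step j w) (ix ∷ ins) iz ℓ∉ with avoiding-sameSide w ins iz (λ a → ℓ∉ (there a))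
  ... | s , ss = ⇔-trans first s , ⇔-refl ∷ All.map (⇔-trans first) ss
    where first = keeps j ix (walk-source w ins iz) (λ e → ℓ∉ (here (sym e)))

  once-crosses : ∀ {x z ps} → Walk n D x z ps → All In (map proj₂ ps) → In z → Unique (map proj₁ ps) →
                 ℓ ∈ map proj₁ ps → ¬ SameSide c x z
  once-crosses (step j w) (ix ∷ ins) iz (ℓ∉ ∷ _) (here refl) s =
    crosses j (⇔-trans s (⇔-sym (proj₁ (avoiding-sameSide w ins iz (All¬⇒¬Any ℓ∉)))))
  once-crosses (step {w₀} j w) (ix ∷ ins) iz (w₀∉ ∷ u) (there ℓ∈) s with w₀ ≟ ℓ
  ... | yes refl = All¬⇒¬Any w₀∉ ℓ∈
  ... | no w₀≢ℓ = once-crosses w ins iz u ℓ∈ (⇔-trans (⇔-sym (keeps j ix (walk-source w ins iz) w₀≢ℓ)) s)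

  closedWalk-sameSide : ∀ {x ps} → Walk n D x x ps → All In (map proj₂ ps) → In x → Unique (map proj₁ ps) →
                        All (SameSide c x) (map proj₂ ps)
  closedWalk-sameSide {ps = ps} w ins ix u with any? (ℓ ≟_) (map proj₁ ps)
  ... | yes ℓ∈ = ⊥-elim (once-crosses w ins ix u ℓ∈ ⇔-refl)
  ... | no ℓ∉ = proj₂ (avoiding-sameSide w ins ix ℓ∉)

sameSide-≤ : ∀ {c x y} → x ≤ c → y ≤ c → SameSide c x y
sameSide-≤ x≤ y≤ = mk⇔ (λ _ → y≤) (λ _ → x≤)

sameSide-> : ∀ {c x y} → c < x → c < y → SameSide c x y
sameSide-> c<x c<y = mk⇔ (λ x≤ → ⊥-elim (<⇒≱ c<x x≤)) (λ y≤ → ⊥-elim (<⇒≱ c<y y≤))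

module IntervalGraph (n : ℕ) {T T' : Tree} (sT : size T ≡ n) (sT' : size T' ≡ n) (T≤T' : T ≤ᵃ T') where
  open Edges n sT sT'

  rightSize≤ : ∀ k → rightSize T k ≤ rightSize T' k
  rightSize≤ = ≤ᵃ⇒rightSize≤ {T} {T'} T≤T'

  Reaches : ℕ → ℕ → Set
  Reaches lo hi = ∀ {v} → lo ≤ v → v ≤ hi → ∃ λ ps → Walk n D (2 * v) (2 * lo) ps

  NoCycleIn : ℕ → ℕ → Set
  NoCycleIn lo hi = ∀ {x p ps} → Walk n D x x (p ∷ ps) → Unique (map proj₁ (p ∷ ps)) →
                    All (Between lo hi) (map proj₂ (p ∷ ps)) → ⊥

  module Root {l r o} (at : SubtreeAt T' (node l r) o) where
    k₀ : ℕ
    k₀ = o + size l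

    hi≡ : suc k₀ + size r ≡ o + size (node l r)
    hi≡ = suc[m+n]+o≡m+suc[n+o] o (size l) (size r)

    In : ℕ → Set
    In = Between o (o + size (node l r))

    k₀<n : k₀ < n
    k₀<n = subst (k₀ <_) sT' (<-≤-trans (+-monoʳ-< o (m<suc[m+n] (size l) (size r))) (SubtreeAt.bounded at))

    start-k₀ : subtreeStart T' k₀ ≡ o
    start-k₀ = trans (subtreeAt-subtreeStart at (m<suc[m+n] (size l) (size r)))
                     (trans (cong (o +_) (subtreeStart-root l r)) (+-identityʳ o))

    end-k₀ : suc (subtreeEnd T k₀) ≤ o + size (node l r)
    end-k₀ = subst (suc (subtreeEnd T k₀) ≤_) hi≡ (s≤s (+-monoʳ-≤ k₀ (begin
      rightSize T k₀                  ≤⟨ rightSize≤ k₀ ⟩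
      rightSize T' k₀                 ≡⟨ subtreeAt-rightSize at (m<suc[m+n] (size l) (size r)) ⟩
      rightSize (node l r) (size l)   ≡⟨ rightSize-root l r ⟩
      size r                          ∎)))
      where open ≤-Reasoning

    left-edge-end : ∀ {k} → o ≤ k → k < k₀ → suc (subtreeEnd T k) ≤ k₀
    left-edge-end {k} o≤k k<k₀ with split≤ o≤k
    ... | q , refl = begin-strict
      o + q + rightSize T (o + q)   ≤⟨ +-monoʳ-≤ (o + q) (rightSize≤ (o + q)) ⟩
      o + q + rightSize T' (o + q)  ≡⟨ cong (o + q +_) (subtreeAt-rightSize (subtreeAt-left at) q<l) ⟩
      o + q + rightSize l q         ≡⟨ +-assoc o q _ ⟩
      o + subtreeEnd l q            <⟨ +-monoʳ-< o (subtreeEnd<size l q q<l) ⟩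
      k₀                            ∎
      where
      open ≤-Reasoning
      q<l : q < size l
      q<l = +-cancelˡ-< o _ _ k<k₀

    right-edge-start : ∀ {k} → k₀ < k → suc (subtreeEnd T k) ≤ o + size (node l r) → k₀ < subtreeStart T' k
    right-edge-start {k} k₀<k end≤ with split≤ k₀<k
    ... | q , refl = subst (k₀ <_) (sym (subtreeAt-subtreeStart (subtreeAt-right at) q<r)) (m<suc[m+n] k₀ _)
      where
      q<r : q < size r
      q<r = +-cancelˡ-< (suc k₀) _ _
              (subst (suc k₀ + q <_) (sym hi≡) (<-≤-trans (s≤s (≤subtreeEnd T _)) end≤))

    edge-keeps : ∀ {k} → k ≢ k₀ → In (2 * subtreeStart T' k) → In (2 * suc (subtreeEnd T k)) →
                 SameSide (2 * k₀) (2 * subtreeStart T' k) (2 * suc (subtreeEnd T k))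
    edge-keeps {k} k≢k₀ (v , e , o≤v , _) (v' , e' , _ , v'≤) with <-cmp k k₀
    ... | tri≈ _ k≡k₀ _ = ⊥-elim (k≢k₀ k≡k₀)
    ... | tri< k<k₀ _ _ =
      sameSide-≤ (double-mono-≤ (≤-trans (subtreeStart≤ T' k) (<⇒≤ k<k₀)))
                 (double-mono-≤ (left-edge-end o≤k k<k₀))
      where
      o≤k : o ≤ k
      o≤k = ≤-trans (subst (o ≤_) (sym (double-injective e)) o≤v) (subtreeStart≤ T' k)
    ... | tri> _ _ k₀<k =
      sameSide-> (*-monoʳ-< 2 (right-edge-start k₀<k end≤)) (*-monoʳ-< 2 (<-trans k₀<k (s≤s (≤subtreeEnd T k))))
      where
      end≤ : suc (subtreeEnd T k) ≤ o + size (node l r)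
      end≤ = subst (_≤ o + size (node l r)) (sym (double-injective e')) v'≤

    non-root-edge-keeps : ∀ {w x y} → Joins n D w x y → In x → In y → w ≢ suc (2 * k₀) →
                          SameSide (2 * k₀) x y
    non-root-edge-keeps j ix iy w≢ with joins⁻ j
    ... | k , _ , refl , inj₁ (refl , refl) = edge-keeps (λ e → w≢ (cong (λ m → suc (2 * m)) e)) ix iy
    ... | k , _ , refl , inj₂ (refl , refl) = ⇔-sym (edge-keeps (λ e → w≢ (cong (λ m → suc (2 * m)) e)) iy ix)

    start-left : 2 * subtreeStart T' k₀ ≤ 2 * k₀
    start-left = double-mono-≤ (subtreeStart≤ T' k₀)

    end-right : ¬ 2 * suc (subtreeEnd T k₀) ≤ 2 * k₀
    end-right = <⇒≱ (*-monoʳ-< 2 (s≤s (≤subtreeEnd T k₀)))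

    root-edge-crosses : ∀ {x y} → Joins n D (suc (2 * k₀)) x y → ¬ SameSide (2 * k₀) x y
    root-edge-crosses j s with joins⁻ j
    ... | k , _ , w≡ , inj₁ (refl , refl) with odd-injective {k₀} {k} w≡
    ...   | refl = end-right (Equivalence.to s start-left)
    root-edge-crosses j s | k , _ , w≡ , inj₂ (refl , refl) with odd-injective {k₀} {k} w≡
    ...   | refl = end-right (Equivalence.from s start-left)

    open Cut {n} {D} In (2 * k₀) (suc (2 * k₀)) non-root-edge-keeps root-edge-crosses public


    root-edge : Joins n D (suc (2 * k₀)) (2 * suc (subtreeEnd T k₀)) (2 * o)
    root-edge = joins-sym {n} {D}
      (subst (λ m → Joins n D (suc (2 * k₀)) (2 * m) (2 * suc (subtreeEnd T k₀))) start-k₀ (edge k₀<n))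

    reaches-node : Reaches o k₀ → Reaches (suc k₀) (suc k₀ + size r) → Reaches o (o + size (node l r))
    reaches-node reachesˡ reachesʳ {v} o≤v v≤ with v ≤? k₀
    ... | yes v≤k₀ = reachesˡ o≤v v≤k₀
    ... | no v≰k₀ with reachesʳ (≰⇒> v≰k₀) (subst (v ≤_) (sym hi≡) v≤)
                     | reachesʳ (s≤s (≤subtreeEnd T k₀)) (subst (suc (subtreeEnd T k₀) ≤_) (sym hi≡) end-k₀)
    ...   | _ , v⇝ | _ , end⇝ = _ , walk-++ v⇝ (walk-++ (proj₂ (walk-reverse end⇝)) (step root-edge nil))

    no-cycle-node : NoCycleIn o k₀ → NoCycleIn (suc k₀) (suc k₀ + size r) → NoCycleIn o (o + size (node l r))
    no-cycle-node acyclicˡ acyclicʳ {x} w u ins with x ≤? 2 * k₀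
    ... | yes x≤ = acyclicˡ w u (All.zipWith (λ (iv , s) → to-left iv (Equivalence.to s x≤)) (ins , sides))
      where
      to-left : ∀ {v} → In v → v ≤ 2 * k₀ → Between o k₀ v
      to-left (u , refl , o≤u , _) ≤k₀ = u , refl , o≤u , double-cancel-≤ ≤k₀
      sides = closedWalk-sameSide w ins (subst In (walk-vertex w) (All.head ins)) u
    ... | no x≰ =
      acyclicʳ w u (All.zipWith (λ (iv , s) → to-right iv (λ v≤ → x≰ (Equivalence.from s v≤))) (ins , sides))
      where
      to-right : ∀ {v} → In v → ¬ v ≤ 2 * k₀ → Between (suc k₀) (suc k₀ + size r) v
      to-right (u , refl , _ , u≤) ≰k₀ = u , refl , double-cancel-< (≰⇒> ≰k₀) , subst (u ≤_) (sym hi≡) u≤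
      sides = closedWalk-sameSide w ins (subst In (walk-vertex w) (All.head ins)) u

  reaches-start : ∀ sub {o} → SubtreeAt T' sub o → Reaches o (o + size sub)
  reaches-start leaf {o} _ o≤v v≤o with ≤-antisym (subst (_ ≤_) (+-identityʳ o) v≤o) o≤v
  ... | refl = [] , nil
  reaches-start (node l r) at =
    Root.reaches-node at (reaches-start l (subtreeAt-left at)) (reaches-start r (subtreeAt-right at))

  no-cycle : ∀ sub {o} → SubtreeAt T' sub o → NoCycleIn o (o + size sub)
  no-cycle leaf {o} _ (step j w) _ (ix ∷ ins) =
    no-loop (subst (Joins n D _ _) (trans (single (walk-source w ins ix)) (sym (single ix))) j)
    where
    single : ∀ {x} → Between o (o + 0) x → x ≡ 2 * o
    single (v , refl , o≤v , v≤) = cong (2 *_) (≤-antisym (subst (v ≤_) (+-identityʳ o) v≤) o≤v)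
  no-cycle (node l r) at = Root.no-cycle-node at (no-cycle l (subtreeAt-left at)) (no-cycle r (subtreeAt-right at))

  connected : Connected n D
  connected _ _ ((v , refl) , 2v≤) ((v' , refl) , 2v'≤) with reaches-start T' subtreeAt-self z≤n (bound v 2v≤)
                                                           | reaches-start T' subtreeAt-self z≤n (bound v' 2v'≤)
    where
    bound : ∀ v → 2 * v ≤ 2 * n → v ≤ size T'
    bound _ 2v≤ = subst (_ ≤_) (sym sT') (double-cancel-≤ 2v≤)
  ... | _ , v⇝ | _ , v'⇝ = _ , walk-++ v⇝ (proj₂ (walk-reverse v'⇝))

  acyclic : ¬ Cycle n D
  acyclic (_ , _ , _ , w , u , _) = no-cycle T' subtreeAt-self w u
    (All.map (λ (v , e , _ , v≤) → v , e , z≤n , subst (v ≤_) (sym sT') v≤) (walk-vertices-bounded w))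

module ConnectedGraph (n : ℕ) {T T' : Tree} (sT : size T ≡ n) (sT' : size T' ≡ n) where
  open Edges n sT sT'

  module LastViolation {j} (j<n : j < n) (bad : rightSize T' j < rightSize T j)
                       (good : ∀ k → j < k → k < n → rightSize T k ≤ rightSize T' k) where
    m : ℕ
    m = suc (subtreeEnd T' j)

    S : ℕ → Set
    S = Between (suc j) m

    m<n : m < n
    m<n = <-≤-trans (s≤s (+-monoʳ-< j bad)) (subst (_ <_) sT (subtreeEnd<size T j (<sizeT j<n)))

    end≰ : ¬ subtreeEnd T j ≤ subtreeEnd T' j
    end≰ p = <⇒≱ bad (+-cancelˡ-≤ j _ _ p)

    start≤j : ∀ {q} → q < n → m ≤ q → subtreeStart T' q ≤ m → subtreeStart T' q ≤ j
    start≤j {q} q<n m≤q start≤m with m≤n⇒m<n∨m≡n m≤q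
    ... | inj₁ m<q = ≤-trans (subtreeStart-nested T' m<q (<sizeT' q<n) start≤m) after
      where after = subtreeStart-after-subtree T' j (<sizeT' m<n)
    ... | inj₂ refl = subtreeStart-after-subtree T' j (<sizeT' m<n)

    end-in : ∀ {q} → q < n → j < subtreeStart T' q → subtreeStart T' q ≤ m → S (2 * suc (subtreeEnd T q))
    end-in {q} q<n j<start start≤m =
      _ , refl , s≤s (≤-trans (<⇒≤ j<q) (≤subtreeEnd T q)) , s≤s end≤
      where
      j<q : j < q
      j<q = <-≤-trans j<start (subtreeStart≤ T' q)
      q≤end : q ≤ subtreeEnd T' j
      q≤end with q ≤? subtreeEnd T' j
      ... | yes q≤ = q≤
      ... | no q≰ = ⊥-elim (<⇒≱ j<start (start≤j q<n (≰⇒> q≰) start≤m))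
      end≤ : subtreeEnd T q ≤ subtreeEnd T' j
      end≤ = ≤-trans (+-monoʳ-≤ q (good q j<q q<n)) (subtreeEnd-nested T' j<q (<sizeT' q<n) q≤end)

    start-in : ∀ {q} → q < n → j ≤ subtreeEnd T q → subtreeEnd T q ≤ subtreeEnd T' j →
               S (2 * subtreeStart T' q)
    start-in {q} q<n j≤end end≤ with <-cmp q j
    ... | tri≈ _ refl _ = ⊥-elim (end≰ end≤)
    ... | tri< q<j _ _  = ⊥-elim (end≰ (≤-trans (subtreeEnd-nested T q<j (<sizeT j<n) j≤end) end≤))
    ... | tri> _ _ j<q  =
      _ , refl , subtreeStart-right-descendant T' j<q (<sizeT' q<n) q≤ ,
      ≤-trans (subtreeStart≤ T' q) (m≤n⇒m≤1+n q≤)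
      where
      q≤ : q ≤ subtreeEnd T' j
      q≤ = ≤-trans (≤subtreeEnd T q) end≤

    edge-closed : ∀ {w x y} → Joins n D w x y → S x → S y
    edge-closed j' (v , e , j<v , v≤m) with joins⁻ j'
    ... | q , q<n , _ , inj₁ (refl , refl) =
      end-in q<n (subst (j <_) (sym v≡) j<v) (subst (_≤ m) (sym v≡) v≤m)
      where v≡ = double-injective e
    ... | q , q<n , _ , inj₂ (refl , refl) =
      start-in q<n (≤-pred (subst (j <_) (sym v≡) j<v)) (≤-pred (subst (_≤ m) (sym v≡) v≤m))
      where v≡ = double-injective e

    walk-closed : ∀ {x z ps} → Walk n D x z ps → S x → S z
    walk-closed nil s = s
    walk-closed (step j' w) s = walk-closed w (edge-closed j' s)

    impossible : Connected n D → ⊥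
    impossible C with C (2 * suc j) (2 * n) ((suc j , refl) , double-mono-≤ j<n) ((n , refl) , ≤-refl)
    ... | _ , w with walk-closed w (suc j , refl , ≤-refl , s≤s (≤subtreeEnd T' j))
    ...   | v , e , _ , v≤m = <⇒≱ m<n (subst (_≤ m) (sym (double-injective e)) v≤m)

  connected⇒≤ᵃ : Connected n D → T ≤ᵃ T'
  connected⇒≤ᵃ C with lastCounterexample (λ k → rightSize T k ≤? rightSize T' k) n
  ... | inj₁ ok = rightSize≤⇒≤ᵃ (trans sT (sym sT')) (λ k p → ok k (subst (k <_) sT p))
  ... | inj₂ (j , j<n , ¬ok , good) = ⊥-elim (LastViolation.impossible j<n (≰⇒> ¬ok) good C)

interval⇒meanderingTree : ∀ n {T T'} → size T ≡ n → size T' ≡ n → T ≤T T' → MeanderingTree n (φ n T T')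
interval⇒meanderingTree n sT sT' T≤T' =
  φ-meandering n sT sT' , connected , acyclic
  where open IntervalGraph n sT sT' (≤T⇒≤ᵃ T≤T')

meanderingTree⇒interval : ∀ {n D} → MeanderingTree n D →
  Σ Tree (λ T → Σ Tree (λ T' → size T ≡ n × size T' ≡ n × T ≤T T' × (φ n T T' ≈D D)))
meanderingTree⇒interval {n} (M , C , _) with FromMeandering.φ-surjective M
... | T , T' , sT , sT' , φ≈D =
  T , T' , sT , sT' , ≤ᵃ⇒≤T (ConnectedGraph.connected⇒≤ᵃ n sT sT' C') , φ≈D
  where
  C' : Connected n (φ n T T')
  C' = connected-map (λ s i j → Equivalence.from (φ≈D s i j)) C

proposition2p10 : (n : ℕ) → 1 ≤ n →
    ((T T' : Tree) → size T ≡ n → size T' ≡ n → Meandering n (φ n T T'))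
    × ((T₁ T₁' T₂ T₂' : Tree) → size T₁ ≡ n → size T₁' ≡ n → size T₂ ≡ n → size T₂' ≡ n →
        φ n T₁ T₁' ≈D φ n T₂ T₂' → (T₁ ≡ T₂) × (T₁' ≡ T₂'))
    × ((D : ArcDiagram) → Meandering n D →
        Σ Tree (λ T → Σ Tree (λ T' → size T ≡ n × size T' ≡ n × (φ n T T' ≈D D))))
    × ((T T' : Tree) → size T ≡ n → size T' ≡ n → T ≤T T' → MeanderingTree n (φ n T T'))
    × ((D : ArcDiagram) → MeanderingTree n D →
        Σ Tree (λ T → Σ Tree (λ T' → size T ≡ n × size T' ≡ n × T ≤T T' × (φ n T T' ≈D D))))
proposition2p10 n _ =
    (λ _ _ → φ-meandering n)
  , (λ _ _ _ _ → φ-injective n)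
  , (λ _ → FromMeandering.φ-surjective)
  , (λ _ _ → interval⇒meanderingTree n)
  , (λ _ → meanderingTree⇒interval)
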